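{- Let $\mathbb{F}$ be a field of characteristic zero, $B\in\mathbb{F}^{n\times n}$ symmetric, $G=G(\mathbf 1,B)$, and let $G'=G(a',B')$ be its twin-reduced graph. Then $\Gamma(\mathbf 1,B)$ acts transitively on $G$ if and only if $\Gamma(a',B')$ acts transitively on $G'$; and $\Gamma(\mathbf 1,B)$ acts generously transitively on $G$ if and only if $\Gamma(a',B')$ acts generously transitively on $G'$.
   Context: $G(a,B)$ denotes the weighted graph on $[n]$ with vertex weights $a_i$ and edge weights $B_{i,j}$; $\mathbf 1$ is the all-ones vector. Vertices $i,j$ are twins if rows $i$ and $j$ of $B$ are equal; let $C_1,\dots,C_m$ be the twin classes. The twin-reduced graph $G(a',B')$ has vertex set $[m]$, $a'_i=\sum_{j\in C_i}a_j$ (here $=|C_i|$), and $B'$ is obtained from $B$ by deleting, for each $i$, all but one of the rows and columns indexed by $C_i$. $\Gamma(a,B)$ is the group of permutations $\sigma$ of the vertex set with $a_{\sigma(i)}=a_i$ and $B_{\sigma(i),\sigma(j)}=B_{i,j}$. A permutation group $\Gamma$ is generously transitive if for all $u,v$ some $\gamma\in\Gamma$ has $\gamma(u)=v$ and $\gamma(v)=u$. -}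

module Defs where

open import Level using (Level)
open import Algebra.Bundles using (CommutativeRing; Semiring)
open import Data.Nat using (ℕ; suc)
open import Data.Fin using (Fin)
open import Data.Fin.Properties using (_≟_)
open import Data.Fin.Permutation using (Permutation′; _⟨$⟩ʳ_)
open import Data.List using (length; filter; allFin)
open import Data.Product using (Σ; ∃; _×_)
open import Relation.Nullary using (¬_)
open import Relation.Binary.PropositionalEquality using (_≡_)
open import Function.Bundles using (_⇔_)

module _ {c ℓ : Level} (R : CommutativeRing c ℓ) where
  open CommutativeRing R
  open import Algebra.Definitions.RawSemiring (Semiring.rawSemiring semiring) using () renaming (_×_ to _·1×_)

  IsField : Set (c Level.⊔ ℓ)
  IsField = (¬ (1# ≈ 0#)) × (∀ x → ¬ (x ≈ 0#) → ∃ λ y → (x * y) ≈ 1#)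

  CharZero : Set ℓ
  CharZero = ∀ (k : ℕ) → ¬ ((suc k ·1× 1#) ≈ 0#)

  ι : ℕ → Carrier
  ι k = k ·1× 1#

  Symmetric : ∀ {n} → (Fin n → Fin n → Carrier) → Set ℓ
  Symmetric B = ∀ i j → B i j ≈ B j i

  InΓ : ∀ {n} → (Fin n → Carrier) → (Fin n → Fin n → Carrier) → Permutation′ n → Set ℓ
  InΓ a B σ = (∀ i → a (σ ⟨$⟩ʳ i) ≈ a i) × (∀ i j → B (σ ⟨$⟩ʳ i) (σ ⟨$⟩ʳ j) ≈ B i j)

  Transitive : ∀ {n} → (Fin n → Carrier) → (Fin n → Fin n → Carrier) → Set ℓ
  Transitive {n} a B = ∀ (u v : Fin n) → Σ (Permutation′ n) λ σ → InΓ a B σ × (σ ⟨$⟩ʳ u ≡ v)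

  GenerouslyTransitive : ∀ {n} → (Fin n → Carrier) → (Fin n → Fin n → Carrier) → Set ℓ
  GenerouslyTransitive {n} a B = ∀ (u v : Fin n) → Σ (Permutation′ n) λ σ →
    InΓ a B σ × (σ ⟨$⟩ʳ u ≡ v) × (σ ⟨$⟩ʳ v ≡ u)

  Twins : ∀ {n} → (Fin n → Fin n → Carrier) → Fin n → Fin n → Set ℓ
  Twins B i j = ∀ k → B i k ≈ B j k

  -- A twin reduction of B: the m twin classes C_1..C_m, given by a class map
  -- `cls` (cls v = index of the class of v) and a choice `rep` of one vertex per class.
  record TwinReduction {n : ℕ} (B : Fin n → Fin n → Carrier) : Set ℓ where
    field
      m     : ℕ
      cls   : Fin n → Fin m
      rep   : Fin m → Fin n
      twins⇔sameClass : ∀ i j → Twins B i j ⇔ (cls i ≡ cls j)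
      rep-in-class    : ∀ k → cls (rep k) ≡ k

    classSize : Fin m → ℕ
    classSize k = length (filter (λ v → cls v ≟ k) (allFin n))

    -- a'_k = Σ_{j ∈ C_k} a_j with a = 1, i.e. |C_k| · 1
    a′ : Fin m → Carrier
    a′ k = ι (classSize k)

    B′ : Fin m → Fin m → Carrier
    B′ k l = B (rep k) (rep l)

-- Γ(1, B) preserves the twin relation, so each of its elements induces a permutation
-- of the twin classes; this permutation preserves B′ (twins have equal rows and, B
-- being symmetric, equal columns) and the class sizes, i.e. it lies in Γ(a′, B′).
-- Conversely, since the characteristic is zero, a permutation τ ∈ Γ(a′, B′) preserves
-- the class sizes, so it lifts to a vertex permutation σ ∈ Γ(1, B) mapping each class
-- C onto τ(C).  Both transitivity statements transfer along these two maps, using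
-- transpositions of twins (which lie in Γ(1, B)) to correct a vertex within its class.
module Submission where

open import Defs
open import Level using (Level)
open import Algebra.Bundles using (CommutativeRing)
open import Data.Nat using (ℕ; zero; suc; _<_)
import Data.Nat.Properties as ℕ
open import Data.Fin using (Fin; zero; suc; punchIn)
open import Data.Fin.Properties using (_≟_)
open import Data.Fin.Permutation as Perm
  using (Permutation′; _⟨$⟩ʳ_; _⟨$⟩ˡ_; _∘ₚ_; flip; transpose; inverseʳ)
import Data.Fin.Permutation.Components as PC
open import Data.List using (length; filter; tabulate)
open import Data.Product using (Σ; ∃; _,_; proj₁; proj₂; _×_)
open import Function.Base using (_∘_; id)
open import Function.Bundles using (_⇔_; mk⇔; Equivalence; Injection)
open import Function.Properties.Inverse using (↔⇒↣)
open import Relation.Binary.Definitions using (tri<; tri≈; tri>)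
open import Relation.Nullary using (yes; no; ¬_; contradiction)
open import Relation.Binary.PropositionalEquality as ≡ using (_≡_; _≢_; _≗_; refl; cong; ≢-sym)
import Relation.Binary.Reasoning.Setoid

module Fibres where
  open import Data.Nat using (_+_)
  open import Algebra.Properties.CommutativeSemigroup ℕ.+-commutativeSemigroup using (x∙yz≈y∙xz)

  indicator : ∀ {m} → Fin m → Fin m → ℕ
  indicator x a with x ≟ a
  ... | yes _ = 1
  ... | no  _ = 0

  fibreSize : ∀ {n m} → (Fin n → Fin m) → Fin m → ℕ
  fibreSize {zero}  f a = 0
  fibreSize {suc n} f a = indicator (f zero) a + fibreSize (f ∘ suc) a

  length-filter-tabulate : ∀ {n N m} (f : Fin N → Fin m) (a : Fin m) (h : Fin n → Fin N) →
    length (filter (λ v → f v ≟ a) (tabulate h)) ≡ fibreSize (f ∘ h) a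
  length-filter-tabulate {zero}  f a h = refl
  length-filter-tabulate {suc n} f a h with f (h zero) ≟ a
  ... | yes _ = cong suc (length-filter-tabulate f a (h ∘ suc))
  ... | no  _ = length-filter-tabulate f a (h ∘ suc)

  indicator-self : ∀ {m} (x : Fin m) → indicator x x ≡ 1
  indicator-self x with x ≟ x
  ... | yes _   = refl
  ... | no  x≢x = contradiction refl x≢x

  indicator-cong : ∀ {m} {x a y b : Fin m} → (x ≡ a ⇔ y ≡ b) → indicator x a ≡ indicator y b
  indicator-cong {x = x} {a} {y} {b} x≡a⇔y≡b with x ≟ a | y ≟ b
  ... | yes _   | yes _   = refl
  ... | no  _   | no  _   = refl
  ... | yes x≡a | no  y≢b = contradiction (Equivalence.to x≡a⇔y≡b x≡a) y≢b
  ... | no  x≢a | yes y≡b = contradiction (Equivalence.from x≡a⇔y≡b y≡b) x≢a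

  fibreSize-cong : ∀ {n m} (f g : Fin n → Fin m) {a b : Fin m} →
    (∀ i → f i ≡ a ⇔ g i ≡ b) → fibreSize f a ≡ fibreSize g b
  fibreSize-cong {zero}  f g eq = refl
  fibreSize-cong {suc n} f g eq =
    ≡.cong₂ _+_ (indicator-cong (eq zero)) (fibreSize-cong (f ∘ suc) (g ∘ suc) (eq ∘ suc))

  fibreSize-≗ : ∀ {n m} {f g : Fin n → Fin m} → f ≗ g → fibreSize f ≗ fibreSize g
  fibreSize-≗ {f = f} {g} f≗g a =
    fibreSize-cong f g λ i → mk⇔ (≡.trans (≡.sym (f≗g i))) (≡.trans (f≗g i))

  fibreSize-permute : ∀ {n m} (π : Permutation′ m) (f : Fin n → Fin m) (a : Fin m) →
    fibreSize ((π ⟨$⟩ʳ_) ∘ f) (π ⟨$⟩ʳ a) ≡ fibreSize f a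
  fibreSize-permute π f a =
    fibreSize-cong _ f λ i → mk⇔ (Injection.injective (↔⇒↣ π)) (cong (π ⟨$⟩ʳ_))

  fibreSize-punchIn : ∀ {n m} (g : Fin (suc n) → Fin m) (j : Fin (suc n)) (a : Fin m) →
    fibreSize g a ≡ indicator (g j) a + fibreSize (g ∘ punchIn j) a
  fibreSize-punchIn g zero a = refl
  fibreSize-punchIn {suc n} g (suc j) a =
    ≡.trans (cong (indicator (g zero) a +_) (fibreSize-punchIn (g ∘ suc) j a))
      (x∙yz≈y∙xz (indicator (g zero) a) (indicator (g (suc j)) a) (fibreSize (g ∘ suc ∘ punchIn j) a))

  fibreSize-∘ₚ : ∀ {n m} (f : Fin n → Fin m) (π : Permutation′ n) (a : Fin m) →
    fibreSize (f ∘ (π ⟨$⟩ʳ_)) a ≡ fibreSize f a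
  fibreSize-∘ₚ {zero}  f π a = refl
  fibreSize-∘ₚ {suc n} f π a = begin
    indicator (f j) a + fibreSize (f ∘ (π ⟨$⟩ʳ_) ∘ suc) a
      ≡⟨ cong (indicator (f j) a +_) (fibreSize-≗ (cong f ∘ Perm.punchIn-permute π zero) a) ⟩
    indicator (f j) a + fibreSize (f ∘ punchIn j ∘ (π₀ ⟨$⟩ʳ_)) a
      ≡⟨ cong (indicator (f j) a +_) (fibreSize-∘ₚ (f ∘ punchIn j) π₀ a) ⟩
    indicator (f j) a + fibreSize (f ∘ punchIn j) a
      ≡⟨ fibreSize-punchIn f j a ⟨
    fibreSize f a ∎
    where
    open ≡.≡-Reasoning
    j : Fin (suc n)
    j = π ⟨$⟩ʳ zero
    π₀ : Permutation′ n
    π₀ = Perm.remove zero π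

  fibreSize≢0⇒∃ : ∀ {n m} (g : Fin n → Fin m) {a : Fin m} → fibreSize g a ≢ 0 → ∃ λ j → g j ≡ a
  fibreSize≢0⇒∃ {zero}  g size≢0 = contradiction refl size≢0
  fibreSize≢0⇒∃ {suc n} g {a} size≢0 with g zero ≟ a
  ... | yes g0≡a = zero , g0≡a
  ... | no  _    = let j , gj≡a = fibreSize≢0⇒∃ (g ∘ suc) size≢0 in suc j , gj≡a

  fibreSizes⇒permutation : ∀ {n m} (f g : Fin n → Fin m) → (∀ a → fibreSize f a ≡ fibreSize g a) →
    Σ (Permutation′ n) λ π → ∀ i → g (π ⟨$⟩ʳ i) ≡ f i
  fibreSizes⇒permutation {zero}  f g _    = Perm.id , λ ()
  fibreSizes⇒permutation {suc n} f g f~g = Perm.insert zero j ρ , insert-correct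
    where
    open ≡.≡-Reasoning
    g-fibre-f0 : fibreSize g (f zero) ≡ suc (fibreSize (f ∘ suc) (f zero))
    g-fibre-f0 = ≡.trans (≡.sym (f~g (f zero)))
                         (cong (_+ fibreSize (f ∘ suc) (f zero)) (indicator-self (f zero)))
    g-hits-f0 : ∃ λ j → g j ≡ f zero
    g-hits-f0 = fibreSize≢0⇒∃ g λ size≡0 → ℕ.1+n≢0 (≡.trans (≡.sym g-fibre-f0) size≡0)
    j : Fin (suc n)
    j = proj₁ g-hits-f0
    rest~ : ∀ a → fibreSize (f ∘ suc) a ≡ fibreSize (g ∘ punchIn j) a
    rest~ a = ℕ.+-cancelˡ-≡ (indicator (f zero) a) _ _ (begin
      indicator (f zero) a + fibreSize (f ∘ suc) a
        ≡⟨ f~g a ⟩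
      fibreSize g a
        ≡⟨ fibreSize-punchIn g j a ⟩
      indicator (g j) a + fibreSize (g ∘ punchIn j) a
        ≡⟨ cong (λ x → indicator x a + fibreSize (g ∘ punchIn j) a) (proj₂ g-hits-f0) ⟩
      indicator (f zero) a + fibreSize (g ∘ punchIn j) a  ∎)
    rest-matched : Σ (Permutation′ n) λ ρ → ∀ i → g (punchIn j (ρ ⟨$⟩ʳ i)) ≡ f (suc i)
    rest-matched = fibreSizes⇒permutation (f ∘ suc) (g ∘ punchIn j) rest~
    ρ : Permutation′ n
    ρ = proj₁ rest-matched
    insert-correct : ∀ i → g (Perm.insert zero j ρ ⟨$⟩ʳ i) ≡ f i
    insert-correct zero    = proj₂ g-hits-f0
    insert-correct (suc i) = ≡.trans (cong g (Perm.insert-punchIn zero j ρ i)) (proj₂ rest-matched i)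

open Fibres

transpose-left : ∀ {n} (x y : Fin n) → PC.transpose x y x ≡ y
transpose-left x y with x ≟ x
... | yes _   = refl
... | no  x≢x = contradiction refl x≢x

transpose-right : ∀ {n} (x y : Fin n) → PC.transpose x y y ≡ x
transpose-right x y with y ≟ x
... | yes y≡x = y≡x
... | no  _ with y ≟ y
...   | yes _   = refl
...   | no  y≢y = contradiction refl y≢y

transpose-other : ∀ {n} {x y k : Fin n} → k ≢ x → k ≢ y → PC.transpose x y k ≡ k
transpose-other {x = x} {y} {k} k≢x k≢y with k ≟ x
... | yes k≡x = contradiction k≡x k≢x
... | no  _ with k ≟ y
...   | yes k≡y = contradiction k≡y k≢y
...   | no  _   = refl

transpose-related : ∀ {n r} (R : Fin n → Fin n → Set r) → (∀ {k} → R k k) →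
  ∀ {x y} → R y x → R x y → ∀ k → R (PC.transpose x y k) k
transpose-related R R-refl {x} {y} Ryx Rxy k with k ≟ x
... | yes refl = Ryx
... | no  _ with k ≟ y
...   | yes refl = Rxy
...   | no  _    = R-refl

module _ {c ℓ : Level} (F : CommutativeRing c ℓ) where
  open CommutativeRing F renaming (refl to ≈-refl)
  open import Algebra.Properties.Group +-group using (identityʳ-unique)
  open import Algebra.Properties.Semiring.Mult semiring using (×-homo-+)
  open import Data.Nat using () renaming (_+_ to _+ℕ_)
  module ≈ = Relation.Binary.Reasoning.Setoid setoid

  ι-<⇒≉ : CharZero F → ∀ {a b} → a < b → ¬ (ι F a ≈ ι F b)
  ι-<⇒≉ char0 {a} a<b ιa≈ιb with k , refl ← ℕ.m≤n⇒∃[o]m+o≡n a<b =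
    char0 k (identityʳ-unique (ι F a) (ι F (suc k)) (begin
      ι F a + ι F (suc k)  ≈⟨ ×-homo-+ 1# a (suc k) ⟨
      ι F (a +ℕ suc k)     ≡⟨ cong (ι F) (ℕ.+-suc a k) ⟩
      ι F (suc a +ℕ k)     ≈⟨ ιa≈ιb ⟨
      ι F a                ∎))
    where open ≈

  ι-injective : CharZero F → ∀ {a b} → ι F a ≈ ι F b → a ≡ b
  ι-injective char0 {a} {b} ιa≈ιb with ℕ.<-cmp a b
  ... | tri< a<b _ _ = contradiction ιa≈ιb (ι-<⇒≉ char0 a<b)
  ... | tri≈ _ a≡b _ = a≡b
  ... | tri> _ _ b<a = contradiction (sym ιa≈ιb) (ι-<⇒≉ char0 b<a)

  module _ {n : ℕ} {a : Fin n → Carrier} {B : Fin n → Fin n → Carrier} where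

    InΓ-∘ₚ : ∀ {σ ρ} → InΓ F a B σ → InΓ F a B ρ → InΓ F a B (σ ∘ₚ ρ)
    InΓ-∘ₚ (σa , σB) (ρa , ρB) = (λ i → trans (ρa _) (σa i)) , λ i j → trans (ρB _ _) (σB i j)

    InΓ-flip : ∀ {σ} → InΓ F a B σ → InΓ F a B (flip σ)
    InΓ-flip {σ} (σa , σB) =
      (λ i → trans (sym (σa (σ ⟨$⟩ˡ i))) (reflexive (cong a (inverseʳ σ)))) ,
      λ i j → trans (sym (σB (σ ⟨$⟩ˡ i) (σ ⟨$⟩ˡ j)))
                    (reflexive (≡.cong₂ B (inverseʳ σ) (inverseʳ σ)))

    InΓ-twins : ∀ {σ i j} → InΓ F a B σ → Twins F B i j → Twins F B (σ ⟨$⟩ʳ i) (σ ⟨$⟩ʳ j)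
    InΓ-twins {σ} {i} {j} (_ , σB) i~j k = begin
      B (σ ⟨$⟩ʳ i) k                    ≡⟨ cong (B (σ ⟨$⟩ʳ i)) (inverseʳ σ) ⟨
      B (σ ⟨$⟩ʳ i) (σ ⟨$⟩ʳ (σ ⟨$⟩ˡ k))  ≈⟨ σB i (σ ⟨$⟩ˡ k) ⟩
      B i (σ ⟨$⟩ˡ k)                    ≈⟨ i~j (σ ⟨$⟩ˡ k) ⟩
      B j (σ ⟨$⟩ˡ k)                    ≈⟨ σB j (σ ⟨$⟩ˡ k) ⟨
      B (σ ⟨$⟩ʳ j) (σ ⟨$⟩ʳ (σ ⟨$⟩ˡ k))  ≡⟨ cong (B (σ ⟨$⟩ʳ j)) (inverseʳ σ) ⟩
      B (σ ⟨$⟩ʳ j) k                    ∎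
      where open ≈

  module _ {n : ℕ} {B : Fin n → Fin n → Carrier} where

    Twins-sym : ∀ {i j} → Twins F B i j → Twins F B j i
    Twins-sym i~j k = sym (i~j k)

    twins-cong : Symmetric F B → ∀ {x x′ y y′} → Twins F B x x′ → Twins F B y y′ → B x y ≈ B x′ y′
    twins-cong B-sym {x} {x′} {y} {y′} x~x′ y~y′ = begin
      B x y    ≈⟨ x~x′ y ⟩
      B x′ y   ≈⟨ B-sym x′ y ⟩
      B y x′   ≈⟨ y~y′ x′ ⟩
      B y′ x′  ≈⟨ B-sym y′ x′ ⟩
      B x′ y′  ∎
      where open ≈

    transpose-InΓ : Symmetric F B → ∀ {a : Fin n → Carrier} {x y} →
      a x ≈ a y → Twins F B x y → InΓ F a B (transpose x y)
    transpose-InΓ B-sym {a} {x} {y} ax≈ay x~y =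
      transpose-related (λ i j → a i ≈ a j) ≈-refl (sym ax≈ay) ax≈ay ,
      λ i j → twins-cong B-sym (twin-moved i) (twin-moved j)
      where
      twin-moved : ∀ k → Twins F B (PC.transpose x y k) k
      twin-moved = transpose-related (Twins F B) (λ _ → ≈-refl) (Twins-sym x~y) x~y

  module TwinReduced {n : ℕ} {B : Fin n → Fin n → Carrier} (B-sym : Symmetric F B) (T : TwinReduction F B)
    where
    open TwinReduction T

    Γ : Permutation′ n → Set ℓ
    Γ = InΓ F (λ _ → 1#) B

    Γ′ : Permutation′ m → Set ℓ
    Γ′ = InΓ F a′ B′

    twins⇒cls≡ : ∀ {i j} → Twins F B i j → cls i ≡ cls j
    twins⇒cls≡ {i} {j} = Equivalence.to (twins⇔sameClass i j)

    cls≡⇒twins : ∀ {i j} → cls i ≡ cls j → Twins F B i j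
    cls≡⇒twins {i} {j} = Equivalence.from (twins⇔sameClass i j)

    B≈B′ : ∀ i j → B i j ≈ B′ (cls i) (cls j)
    B≈B′ i j = twins-cong B-sym (twin-rep i) (twin-rep j)
      where twin-rep : ∀ i → Twins F B i (rep (cls i))
            twin-rep i = cls≡⇒twins (≡.sym (rep-in-class (cls i)))

    classSize≡fibreSize : ∀ k → classSize k ≡ fibreSize cls k
    classSize≡fibreSize k = length-filter-tabulate cls k id

    record _LiesOver_ (σ : Permutation′ n) (τ : Permutation′ m) : Set where
      constructor liesOver
      field cls-commutes : ∀ i → cls (σ ⟨$⟩ʳ i) ≡ τ ⟨$⟩ʳ cls i

    module _ {σ : Permutation′ n} {τ : Permutation′ m} (σ/τ : σ LiesOver τ) where
      open _LiesOver_ σ/τ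

      liesOver-classSize : ∀ k → classSize (τ ⟨$⟩ʳ k) ≡ classSize k
      liesOver-classSize k = begin
        classSize (τ ⟨$⟩ʳ k)                    ≡⟨ classSize≡fibreSize (τ ⟨$⟩ʳ k) ⟩
        fibreSize cls (τ ⟨$⟩ʳ k)                ≡⟨ fibreSize-∘ₚ cls σ (τ ⟨$⟩ʳ k) ⟨
        fibreSize (cls ∘ (σ ⟨$⟩ʳ_)) (τ ⟨$⟩ʳ k)  ≡⟨ fibreSize-≗ cls-commutes (τ ⟨$⟩ʳ k) ⟩
        fibreSize ((τ ⟨$⟩ʳ_) ∘ cls) (τ ⟨$⟩ʳ k)  ≡⟨ fibreSize-permute τ cls k ⟩
        fibreSize cls k                         ≡⟨ classSize≡fibreSize k ⟨
        classSize k                             ∎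
        where open ≡.≡-Reasoning

      liesOver-B : ∀ i j → B (σ ⟨$⟩ʳ i) (σ ⟨$⟩ʳ j) ≈ B′ (τ ⟨$⟩ʳ cls i) (τ ⟨$⟩ʳ cls j)
      liesOver-B i j = trans (B≈B′ _ _) (reflexive (≡.cong₂ B′ (cls-commutes i) (cls-commutes j)))

      liesOver-rep : ∀ {k l} → σ ⟨$⟩ʳ rep k ≡ rep l → τ ⟨$⟩ʳ k ≡ l
      liesOver-rep {k} {l} σk≡l = begin
        τ ⟨$⟩ʳ k                ≡⟨ cong (τ ⟨$⟩ʳ_) (rep-in-class k) ⟨
        τ ⟨$⟩ʳ cls (rep k)      ≡⟨ cls-commutes (rep k) ⟨
        cls (σ ⟨$⟩ʳ rep k)      ≡⟨ cong cls σk≡l ⟩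
        cls (rep l)             ≡⟨ rep-in-class l ⟩
        l                       ∎
        where open ≡.≡-Reasoning

      liesOver-cls : ∀ {i k} → τ ⟨$⟩ʳ cls i ≡ k → cls (σ ⟨$⟩ʳ i) ≡ k
      liesOver-cls = ≡.trans (cls-commutes _)

    classMap : Permutation′ n → Fin m → Fin m
    classMap σ k = cls (σ ⟨$⟩ʳ rep k)

    classMap-commutes : ∀ {σ} → Γ σ → ∀ i → cls (σ ⟨$⟩ʳ i) ≡ classMap σ (cls i)
    classMap-commutes {σ} σ∈Γ i =
      twins⇒cls≡ (InΓ-twins {σ = σ} σ∈Γ (cls≡⇒twins (≡.sym (rep-in-class (cls i)))))

    classMap-flip : ∀ {σ} → Γ σ → ∀ k → classMap σ (classMap (flip σ) k) ≡ k
    classMap-flip {σ} σ∈Γ k = begin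
      classMap σ (cls (σ ⟨$⟩ˡ rep k))  ≡⟨ classMap-commutes {σ} σ∈Γ (σ ⟨$⟩ˡ rep k) ⟨
      cls (σ ⟨$⟩ʳ (σ ⟨$⟩ˡ rep k))       ≡⟨ cong cls (inverseʳ σ) ⟩
      cls (rep k)                      ≡⟨ rep-in-class k ⟩
      k                                ∎
      where open ≡.≡-Reasoning

    project : ∀ σ → Γ σ → Σ (Permutation′ m) λ τ → Γ′ τ × σ LiesOver τ
    project σ σ∈Γ@(_ , σB) = τ , (size , B′-preserved) , σ/τ
      where
      τ : Permutation′ m
      τ = Perm.permutation (classMap σ) (classMap (flip σ))
            (classMap-flip {σ} σ∈Γ) (classMap-flip {flip σ} (InΓ-flip {σ = σ} σ∈Γ))
      σ/τ : σ LiesOver τ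
      σ/τ = liesOver (classMap-commutes {σ} σ∈Γ)
      size : ∀ k → a′ (τ ⟨$⟩ʳ k) ≈ a′ k
      size k = reflexive (cong (ι F) (liesOver-classSize σ/τ k))
      B′-preserved : ∀ k l → B′ (τ ⟨$⟩ʳ k) (τ ⟨$⟩ʳ l) ≈ B′ k l
      B′-preserved k l = trans (sym (B≈B′ _ _)) (σB (rep k) (rep l))

    lift : CharZero F → ∀ τ → Γ′ τ → Σ (Permutation′ n) λ σ → Γ σ × σ LiesOver τ
    lift char0 τ (τa , τB) = σ , ((λ _ → ≈-refl) , B-preserved) , σ/τ
      where
      fibres : ∀ k → fibreSize ((τ ⟨$⟩ʳ_) ∘ cls) k ≡ fibreSize cls k
      fibres k = begin
        fibreSize ((τ ⟨$⟩ʳ_) ∘ cls) k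
          ≡⟨ cong (fibreSize ((τ ⟨$⟩ʳ_) ∘ cls)) (inverseʳ τ) ⟨
        fibreSize ((τ ⟨$⟩ʳ_) ∘ cls) (τ ⟨$⟩ʳ (τ ⟨$⟩ˡ k))
          ≡⟨ fibreSize-permute τ cls (τ ⟨$⟩ˡ k) ⟩
        fibreSize cls (τ ⟨$⟩ˡ k)
          ≡⟨ classSize≡fibreSize (τ ⟨$⟩ˡ k) ⟨
        classSize (τ ⟨$⟩ˡ k)
          ≡⟨ ι-injective char0 (τa (τ ⟨$⟩ˡ k)) ⟨
        classSize (τ ⟨$⟩ʳ (τ ⟨$⟩ˡ k))
          ≡⟨ cong classSize (inverseʳ τ) ⟩
        classSize k
          ≡⟨ classSize≡fibreSize k ⟩
        fibreSize cls k  ∎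
        where open ≡.≡-Reasoning
      matched : Σ (Permutation′ n) λ σ → ∀ i → cls (σ ⟨$⟩ʳ i) ≡ τ ⟨$⟩ʳ cls i
      matched = fibreSizes⇒permutation ((τ ⟨$⟩ʳ_) ∘ cls) cls fibres
      σ : Permutation′ n
      σ = proj₁ matched
      σ/τ : σ LiesOver τ
      σ/τ = liesOver (proj₂ matched)
      B-preserved : ∀ i j → B (σ ⟨$⟩ʳ i) (σ ⟨$⟩ʳ j) ≈ B i j
      B-preserved i j = trans (liesOver-B σ/τ i j) (trans (τB (cls i) (cls j)) (sym (B≈B′ i j)))

    swap-within-class : ∀ {u v} → cls u ≡ cls v →
      Σ (Permutation′ n) λ ρ → Γ ρ × ρ ⟨$⟩ʳ u ≡ v × ρ ⟨$⟩ʳ v ≡ u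
    swap-within-class {u} {v} u≈v =
      transpose u v , transpose-InΓ B-sym ≈-refl (cls≡⇒twins u≈v) , transpose-left u v , transpose-right u v

    swap-across-classes : ∀ {u v x y} → cls u ≢ cls v → cls x ≡ cls v → cls y ≡ cls u →
      Σ (Permutation′ n) λ ρ → Γ ρ × ρ ⟨$⟩ʳ x ≡ v × ρ ⟨$⟩ʳ y ≡ u
    swap-across-classes {u} {v} {x} {y} u≉v x≈v y≈u =
      transpose x v ∘ₚ transpose y u ,
      InΓ-∘ₚ {σ = transpose x v} {ρ = transpose y u}
        (transpose-InΓ B-sym ≈-refl (cls≡⇒twins x≈v)) (transpose-InΓ B-sym ≈-refl (cls≡⇒twins y≈u)) ,
      ≡.trans (cong (PC.transpose y u) (transpose-left x v)) (transpose-other (≢-sym y≢v) (≢-sym u≢v)) ,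
      ≡.trans (cong (PC.transpose y u) (transpose-other (apart y≈u x≈v) y≢v)) (transpose-left y u)
      where
      apart : ∀ {p q} → cls p ≡ cls u → cls q ≡ cls v → p ≢ q
      apart p≈u q≈v refl = u≉v (≡.trans (≡.sym p≈u) q≈v)
      y≢v : y ≢ v
      y≢v = apart y≈u refl
      u≢v : u ≢ v
      u≢v = apart refl refl

    transitive⇒reduced : Transitive F (λ _ → 1#) B → Transitive F a′ B′
    transitive⇒reduced transitive k l
      with σ , σ∈Γ , σk≡l ← transitive (rep k) (rep l)
      with τ , τ∈Γ′ , σ/τ ← project σ σ∈Γ
      = τ , τ∈Γ′ , liesOver-rep σ/τ σk≡l

    reduced⇒transitive : CharZero F → Transitive F a′ B′ → Transitive F (λ _ → 1#) B
    reduced⇒transitive char0 transitive u v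
      with τ , τ∈Γ′ , τu≡v ← transitive (cls u) (cls v)
      with σ , σ∈Γ , σ/τ ← lift char0 τ τ∈Γ′
      with ρ , ρ∈Γ , ρσu≡v , _ ← swap-within-class (liesOver-cls σ/τ τu≡v)
      = σ ∘ₚ ρ , InΓ-∘ₚ {σ = σ} {ρ = ρ} σ∈Γ ρ∈Γ , ρσu≡v

    generous⇒reduced : GenerouslyTransitive F (λ _ → 1#) B → GenerouslyTransitive F a′ B′
    generous⇒reduced generous k l
      with σ , σ∈Γ , σk≡l , σl≡k ← generous (rep k) (rep l)
      with τ , τ∈Γ′ , σ/τ ← project σ σ∈Γ
      = τ , τ∈Γ′ , liesOver-rep σ/τ σk≡l , liesOver-rep σ/τ σl≡k

    reduced⇒generous : CharZero F → GenerouslyTransitive F a′ B′ → GenerouslyTransitive F (λ _ → 1#) B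
    reduced⇒generous char0 generous u v with cls u ≟ cls v
    ... | yes u≈v = swap-within-class u≈v
    ... | no  u≉v
      with τ , τ∈Γ′ , τu≡v , τv≡u ← generous (cls u) (cls v)
      with σ , σ∈Γ , σ/τ ← lift char0 τ τ∈Γ′
      with ρ , ρ∈Γ , ρσu≡v , ρσv≡u
             ← swap-across-classes u≉v (liesOver-cls σ/τ τu≡v) (liesOver-cls σ/τ τv≡u)
      = σ ∘ₚ ρ , InΓ-∘ₚ {σ = σ} {ρ = ρ} σ∈Γ ρ∈Γ , ρσu≡v , ρσv≡u

lemma3 : ∀ {c ℓ : Level} (F : CommutativeRing c ℓ) → IsField F → CharZero F →
    (n : ℕ) (B : Fin n → Fin n → CommutativeRing.Carrier F) → Symmetric F B →
    (T : TwinReduction F B) →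
      (Transitive F (λ _ → CommutativeRing.1# F) B ⇔ Transitive F (TwinReduction.a′ T) (TwinReduction.B′ T))
      × (GenerouslyTransitive F (λ _ → CommutativeRing.1# F) B ⇔ GenerouslyTransitive F (TwinReduction.a′ T) (TwinReduction.B′ T))
lemma3 F _ char0 n B B-sym T =
  mk⇔ transitive⇒reduced (reduced⇒transitive char0) ,
  mk⇔ generous⇒reduced (reduced⇒generous char0)
  where open TwinReduced F B-sym T
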